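{- For every positive integer $n$, the number $f_0(\mathcal{L}_n)$ of vertices of $\mathcal{L}_n$ satisfies $$f_0(\mathcal{L}_n)\le \binom{n^3+3n^2-3n+1}{n^3}.$$
   Context: $\mathcal{L}_n\subset\mathbb{R}^{n^3}$ is the polytope of $n\times n\times n$ line-stochastic tensors: real arrays $A=(a_{ijk})$, $1\le i,j,k\le n$, with $a_{ijk}\ge 0$, $\sum_i a_{ijk}=1$ for all $j,k$, $\sum_j a_{ijk}=1$ for all $i,k$, and $\sum_k a_{ijk}=1$ for all $i,j$.
   Formalization: The polytope $\mathcal{L}_n$ is taken in ℚ^(n³) rather than ℝ^(n³), so the points and convex-combination coefficients used to test whether a tensor is a vertex are rational too. -}

module Defs where

open import Data.Nat using (ℕ; zero; suc)
open import Data.Fin using (Fin; zero; suc)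
open import Data.Rational using (ℚ; 0ℚ; 1ℚ; _+_; _*_; _-_; _≤_; _<_)
open import Data.Product using (_×_)
open import Data.List using (List)
open import Data.List.Relation.Unary.All using (All)
open import Data.List.Relation.Unary.AllPairs using (AllPairs)
open import Relation.Binary.PropositionalEquality using (_≡_)
open import Relation.Nullary using (¬_)

∑ : (n : ℕ) → (Fin n → ℚ) → ℚ
∑ zero    f = 0ℚ
∑ (suc n) f = f zero + ∑ n (λ i → f (suc i))

Tensor : ℕ → Set
Tensor n = Fin n → Fin n → Fin n → ℚ

_≐_ : {n : ℕ} → Tensor n → Tensor n → Set
_≐_ {n} A B = ∀ (i j k : Fin n) → A i j k ≡ B i j k

LineStochastic : (n : ℕ) → Tensor n → Set
LineStochastic n A =
  (∀ (i j k : Fin n) → 0ℚ ≤ A i j k)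
  × (∀ (j k : Fin n) → ∑ n (λ i → A i j k) ≡ 1ℚ)
  × (∀ (i k : Fin n) → ∑ n (λ j → A i j k) ≡ 1ℚ)
  × (∀ (i j : Fin n) → ∑ n (λ k → A i j k) ≡ 1ℚ)

IsVertex : (n : ℕ) → Tensor n → Set
IsVertex n A =
  LineStochastic n A
  × (∀ (B C : Tensor n) (t : ℚ) → LineStochastic n B → LineStochastic n C →
       0ℚ < t → t < 1ℚ →
       (∀ (i j k : Fin n) → A i j k ≡ t * B i j k + (1ℚ - t) * C i j k) →
       (B ≐ A) × (C ≐ A))

-- "f₀(𝓛ₙ) ≤ m": every list of pairwise distinct vertices has length ≤ m
VertexCountAtMost : (n : ℕ) → ℕ → Set
VertexCountAtMost n m =
  ∀ (vs : List (Tensor n)) →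
    All (IsVertex n) vs →
    AllPairs (λ A B → ¬ (A ≐ B)) vs →
    Data.List.length vs Data.Nat.≤ m

{-# OPTIONS --safe #-}
module Submission where

-- A vertex A of 𝓛ₙ admits no nonzero direction D with vanishing line sums and supp D ⊆ supp A:
-- otherwise A ± εD ∈ 𝓛ₙ for small ε > 0 and A is their midpoint. Applied to D = B − A, this shows
-- that a vertex is determined by its support. Applied to tensors supported on supp A, it bounds
-- |supp A| by r = n² + n(n−1) + (n−1)² = 3n² − 3n + 1: all line sums of a tensor vanish as soon as
-- the r sums along k, along j with k ≠ 0, and along i with j, k ≠ 0 do, and r homogeneous linear
-- equations in more than r unknowns (the entries on the support) have a nonzero solution. Hence
-- the vertices inject into the 0/1 patterns on the n³ cells with at most r ones, and there are
-- ∑_{w ≤ r} (n³ choose w) ≤ (n³ + r choose n³) of those.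

open import Level using (0ℓ)
open import Algebra.Bundles using (CommutativeRing)
import Algebra.Properties.Group as GroupProperties
import Algebra.Properties.Semiring.Sum as SemiringSum
open import Data.Bool using (Bool; true; false; if_then_else_)
open import Data.Empty using (⊥-elim)
open import Data.Fin using (Fin; zero; suc; punchIn; punchOut; _↑ˡ_; _↑ʳ_; combine; remQuot)
import Data.Fin.Properties as Fin
open import Data.List using (List; []; _∷_; length; map; lookup; filter; cartesianProduct; allFin)
import Data.List as List
import Data.List.Properties as List
open import Data.List.Membership.Propositional using (_∈_)
open import Data.List.Membership.Propositional.Properties
  using (∈-lookup; ∈-allFin; ∈-cartesianProduct⁺; ∈-map⁺; ∈-++⁺ˡ; ∈-++⁺ʳ)
open import Data.List.Relation.Binary.Subset.Propositional using (_⊆_)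
open import Data.List.Relation.Unary.All using (All; []; _∷_)
import Data.List.Relation.Unary.All as All
import Data.List.Relation.Unary.All.Properties as All
open import Data.List.Relation.Unary.AllPairs using (AllPairs; []; _∷_)
open import Data.List.Relation.Unary.Any using (here; there; _─_)
open import Data.List.Relation.Unary.Unique.Propositional using (Unique)
import Data.List.Relation.Unary.Unique.Propositional.Properties as Unique
open import Data.Nat using (ℕ; zero; suc; s≤s; z≤n)
import Data.Nat.Properties as ℕ
open import Data.Nat.Tactic.RingSolver using () renaming (solve-∀ to ℕ-solve-∀)
open import Data.Product using (_×_; _,_; ∃; proj₁; proj₂)
open import Data.Rational using (ℚ; 0ℚ; 1ℚ)
import Data.Rational as ℚ
import Data.Rational.Properties as ℚ
open import Data.Sum using (inj₁; inj₂)
open import Data.Vec.Functional using (Vector; tail; _++_)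
open import Data.Vec.Functional.Properties using (lookup-++ˡ; lookup-++ʳ)
open import Function using (_∘_)
open import Relation.Binary.PropositionalEquality
  using (_≡_; _≢_; refl; sym; trans; cong; cong₂; subst; module ≡-Reasoning)
open import Relation.Nullary using (¬_; yes; no; does; ¬?; contradiction)
open import Relation.Nullary.Decidable using (from-yes; dec⇒maybe; dec-true; dec-false; decidable-stable)
open import Relation.Unary using (Decidable)
open import Tactic.RingSolver using (solve-∀)
open import Tactic.RingSolver.Core.AlmostCommutativeRing using (AlmostCommutativeRing; fromCommutativeRing)

open import Defs

-- A module of its own so that the ℚ operators opened inside do not clash with the ℕ operators
-- in which the theorem is stated.
module Vertices where

  open import Data.Nat using () renaming (_<_ to _<ℕ_; _≤_ to _≤ℕ_; _+_ to _+ℕ_; _*_ to _*ℕ_)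
  open import Data.Rational using (½; _+_; _*_; _-_; -_; _÷_; ∣_∣; _⊓_; _≤_; _<_)

  -- With a decidable zero test the normaliser can drop cancelled monomials.
  ℚ-ring : AlmostCommutativeRing 0ℓ 0ℓ
  ℚ-ring = fromCommutativeRing ℚ.+-*-commutativeRing (λ x → dec⇒maybe (0ℚ ℚ.≟ x))

  open GroupProperties ℚ.+-0-group using () renaming (identityʳ-unique to +-identityʳ-unique)

  positive*x≡0⇒x≡0 : ∀ {c x} → 0ℚ < c → c * x ≡ 0ℚ → x ≡ 0ℚ
  positive*x≡0⇒x≡0 {c} {x} 0<c cx≡0 = begin
    x              ≡⟨ ℚ.*-identityˡ x ⟨
    1ℚ * x         ≡⟨ cong (_* x) (ℚ.*-inverseˡ c) ⟨
    1/c * c * x    ≡⟨ ℚ.*-assoc 1/c c x ⟩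
    1/c * (c * x)  ≡⟨ cong (1/c *_) cx≡0 ⟩
    1/c * 0ℚ       ≡⟨ ℚ.*-zeroʳ 1/c ⟩
    0ℚ             ∎
    where
    open ≡-Reasoning
    instance _ = ℚ.>-nonZero 0<c
    1/c = ℚ.1/ c

  ∣x∣≤a⇒0≤a+x : ∀ {a x} → ∣ x ∣ ≤ a → 0ℚ ≤ a + x
  ∣x∣≤a⇒0≤a+x {a} {x} ∣x∣≤a with ℚ.∣p∣≡p∨∣p∣≡-p x
  ... | inj₁ ∣x∣≡x  = ℚ.+-mono-≤ (ℚ.≤-trans (ℚ.0≤∣p∣ x) ∣x∣≤a) (subst (0ℚ ≤_) ∣x∣≡x (ℚ.0≤∣p∣ x))
  ... | inj₂ ∣x∣≡-x = subst (_≤ a + x) (ℚ.+-inverseˡ x) (ℚ.+-monoˡ-≤ x (subst (_≤ a) ∣x∣≡-x ∣x∣≤a))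

  module Sum = SemiringSum (CommutativeRing.semiring ℚ.+-*-commutativeRing)
  open Sum using (sum)

  ∑≡sum : ∀ n (f : Vector ℚ n) → ∑ n f ≡ sum f
  ∑≡sum zero    f = refl
  ∑≡sum (suc n) f = cong (f zero +_) (∑≡sum n (tail f))

  ∑-cong : ∀ n {f g : Vector ℚ n} → (∀ i → f i ≡ g i) → ∑ n f ≡ ∑ n g
  ∑-cong zero    f≗g = refl
  ∑-cong (suc n) f≗g = cong₂ _+_ (f≗g zero) (∑-cong n (f≗g ∘ suc))

  ∑-0 : ∀ n {f : Vector ℚ n} → (∀ i → f i ≡ 0ℚ) → ∑ n f ≡ 0ℚ
  ∑-0 zero    f≗0 = refl
  ∑-0 (suc n) f≗0 = trans (cong₂ _+_ (f≗0 zero) (∑-0 n (f≗0 ∘ suc))) (ℚ.+-identityˡ 0ℚ)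

  ∑-distrib-+ : ∀ n (f g : Vector ℚ n) → ∑ n (λ i → f i + g i) ≡ ∑ n f + ∑ n g
  ∑-distrib-+ n f g = begin
    ∑ n (λ i → f i + g i) ≡⟨ ∑≡sum n _ ⟩
    sum (λ i → f i + g i) ≡⟨ Sum.∑-distrib-+ f g ⟩
    sum f + sum g         ≡⟨ cong₂ _+_ (∑≡sum n f) (∑≡sum n g) ⟨
    ∑ n f + ∑ n g         ∎
    where open ≡-Reasoning

  ∑-*ˡ : ∀ n c (f : Vector ℚ n) → ∑ n (λ i → c * f i) ≡ c * ∑ n f
  ∑-*ˡ n c f = begin
    ∑ n (λ i → c * f i) ≡⟨ ∑≡sum n _ ⟩
    sum (λ i → c * f i) ≡⟨ Sum.*-distribˡ-sum c f ⟨
    c * sum f           ≡⟨ cong (c *_) (∑≡sum n f) ⟨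
    c * ∑ n f           ∎
    where open ≡-Reasoning

  ∑-*ʳ : ∀ n c (f : Vector ℚ n) → ∑ n (λ i → f i * c) ≡ ∑ n f * c
  ∑-*ʳ n c f = begin
    ∑ n (λ i → f i * c) ≡⟨ ∑≡sum n _ ⟩
    sum (λ i → f i * c) ≡⟨ Sum.*-distribʳ-sum c f ⟨
    sum f * c           ≡⟨ cong (_* c) (∑≡sum n f) ⟨
    ∑ n f * c           ∎
    where open ≡-Reasoning

  ∑-comm : ∀ m n (f : Fin m → Fin n → ℚ) → ∑ m (λ i → ∑ n (f i)) ≡ ∑ n (λ j → ∑ m (λ i → f i j))
  ∑-comm m n f = begin
    ∑ m (λ i → ∑ n (f i))         ≡⟨ ∑≡sum m _ ⟩
    sum (λ i → ∑ n (f i))         ≡⟨ Sum.sum-cong-≗ (λ i → ∑≡sum n (f i)) ⟩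
    sum (λ i → sum (f i))         ≡⟨ Sum.∑-comm f ⟩
    sum (λ j → sum (λ i → f i j)) ≡⟨ Sum.sum-cong-≗ (λ j → ∑≡sum m (λ i → f i j)) ⟨
    sum (λ j → ∑ m (λ i → f i j)) ≡⟨ ∑≡sum n _ ⟨
    ∑ n (λ j → ∑ m (λ i → f i j)) ∎
    where open ≡-Reasoning

  ∑-single : ∀ n (p : Fin n) (f : Vector ℚ n) → (∀ i → i ≢ p → f i ≡ 0ℚ) → ∑ n f ≡ f p
  ∑-single (suc n) zero    f f≡0 =
    trans (cong (f zero +_) (∑-0 n (λ i → f≡0 (suc i) λ ()))) (ℚ.+-identityʳ (f zero))
  ∑-single (suc n) (suc p) f f≡0 =
    trans (cong₂ _+_ (f≡0 zero λ ()) (∑-single n p (tail f) (λ i i≢p → f≡0 (suc i) (i≢p ∘ Fin.suc-injective))))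
          (ℚ.+-identityˡ (f (suc p)))

  ∑-head : ∀ n (f : Vector ℚ (suc n)) → ∑ (suc n) f ≡ 0ℚ → (∀ i → f (suc i) ≡ 0ℚ) → f zero ≡ 0ℚ
  ∑-head n f ∑f≡0 tail≡0 = begin
    f zero            ≡⟨ ℚ.+-identityʳ (f zero) ⟨
    f zero + 0ℚ       ≡⟨ cong (f zero +_) (∑-0 n tail≡0) ⟨
    ∑ (suc n) f       ≡⟨ ∑f≡0 ⟩
    0ℚ                ∎
    where open ≡-Reasoning

  δ : ∀ {n} → Fin n → Fin n → ℚ
  δ a b = if does (a Fin.≟ b) then 1ℚ else 0ℚ

  δ-refl : ∀ {n} (a : Fin n) → δ a a ≡ 1ℚ
  δ-refl a rewrite dec-true (a Fin.≟ a) refl = refl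

  δ-≢ : ∀ {n} {a b : Fin n} → a ≢ b → δ a b ≡ 0ℚ
  δ-≢ {a = a} {b} a≢b rewrite dec-false (a Fin.≟ b) a≢b = refl

  ∑-δ : ∀ n (a : Fin n) → ∑ n (δ a) ≡ 1ℚ
  ∑-δ n a = trans (∑-single n a (δ a) (λ i i≢a → δ-≢ (i≢a ∘ sym))) (δ-refl a)

  ∑-∑-δ : ∀ n s (a : Fin s → Fin n) (R : Vector ℚ s) → ∑ n (λ i → ∑ s (λ t → δ (a t) i * R t)) ≡ ∑ s R
  ∑-∑-δ n s a R = begin
    ∑ n (λ i → ∑ s (λ t → δ (a t) i * R t)) ≡⟨ ∑-comm n s _ ⟩
    ∑ s (λ t → ∑ n (λ i → δ (a t) i * R t)) ≡⟨ ∑-cong s (λ t → ∑-*ʳ n (R t) (δ (a t))) ⟩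
    ∑ s (λ t → ∑ n (δ (a t)) * R t)         ≡⟨ ∑-cong s (λ t → cong (_* R t) (∑-δ n (a t))) ⟩
    ∑ s (λ t → 1ℚ * R t)                    ≡⟨ ∑-cong s (λ t → ℚ.*-identityˡ (R t)) ⟩
    ∑ s R                                   ∎
    where open ≡-Reasoning

  Nonzero : ∀ {u} → Vector ℚ u → Set
  Nonzero {u} x = ∃ λ (i : Fin u) → x i ≢ 0ℚ

  infix 7 _·_
  _·_ : ∀ {u} → Vector ℚ u → Vector ℚ u → ℚ
  _·_ {u} f x = ∑ u (λ i → f i * x i)

  module BackSubstitution {u} (f : Vector ℚ (suc u)) (pivot≢0 : f zero ≢ 0ℚ) where

    private instance
      pivot-nonZero : ℚ.NonZero (f zero)
      pivot-nonZero = ℚ.≢-nonZero pivot≢0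

    reduce : Vector ℚ (suc u) → Vector ℚ u
    reduce g i = g (suc i) - (g zero ÷ f zero) * f (suc i)

    extend : Vector ℚ u → Vector ℚ (suc u)
    extend y zero    = - (tail f · y) ÷ f zero
    extend y (suc i) = y i

    pivot-row : ∀ y → f · extend y ≡ 0ℚ
    pivot-row y = begin
      f zero * (- S * 1/f₀) + S ≡⟨ regroup (f zero) S 1/f₀ ⟩
      - S * (f zero * 1/f₀) + S ≡⟨ cong (λ c → - S * c + S) (ℚ.*-inverseʳ (f zero)) ⟩
      - S * 1ℚ + S              ≡⟨ cancel S ⟩
      0ℚ                        ∎
      where
      open ≡-Reasoning
      S = tail f · y
      1/f₀ = ℚ.1/ f zero
      regroup : ∀ a s b → a * (- s * b) + s ≡ - s * (a * b) + s
      regroup = solve-∀ ℚ-ring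
      cancel : ∀ s → - s * 1ℚ + s ≡ 0ℚ
      cancel = solve-∀ ℚ-ring

    reduced-row : ∀ g y → g · extend y ≡ reduce g · y
    reduced-row g y = begin
      g zero * (- S * 1/f₀) + tail g · y                    ≡⟨ regroup (g zero) S 1/f₀ (tail g · y) ⟩
      tail g · y + - k * S                                  ≡⟨ cong (tail g · y +_) (∑-*ˡ u (- k) _) ⟨
      tail g · y + ∑ u (λ i → - k * (f (suc i) * y i))      ≡⟨ ∑-distrib-+ u _ _ ⟨
      ∑ u (λ i → g (suc i) * y i + - k * (f (suc i) * y i))
        ≡⟨ ∑-cong u (λ i → distrib (g (suc i)) k (f (suc i)) (y i)) ⟩
      reduce g · y                                          ∎
      where
      open ≡-Reasoning
      S = tail f · y
      1/f₀ = ℚ.1/ f zero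
      k = g zero ÷ f zero
      regroup : ∀ a s b t → a * (- s * b) + t ≡ t + - (a * b) * s
      regroup = solve-∀ ℚ-ring
      distrib : ∀ a k b c → a * c + - k * (b * c) ≡ (a - k * b) * c
      distrib = solve-∀ ℚ-ring

  kernel-nontrivial : ∀ {e u} → e <ℕ u → (M : Fin e → Vector ℚ u) → ∃ λ x → Nonzero x × ∀ r → M r · x ≡ 0ℚ
  kernel-nontrivial {e} {suc u} e<u M with Fin.any? (λ r → ¬? (M r zero ℚ.≟ 0ℚ))
  ... | no no-pivot = e₀ , (zero , λ ()) , rows
    where
    e₀ : Vector ℚ (suc u)
    e₀ zero    = 1ℚ
    e₀ (suc _) = 0ℚ
    rows : ∀ r → M r · e₀ ≡ 0ℚ
    rows r = begin
      M r zero * 1ℚ + ∑ u (λ i → M r (suc i) * 0ℚ)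
        ≡⟨ cong₂ _+_ (ℚ.*-identityʳ (M r zero)) (∑-0 u (λ i → ℚ.*-zeroʳ (M r (suc i)))) ⟩
      M r zero + 0ℚ                               ≡⟨ ℚ.+-identityʳ (M r zero) ⟩
      M r zero                                    ≡⟨ decidable-stable (M r zero ℚ.≟ 0ℚ) (λ Mᵣ≢0 → no-pivot (r , Mᵣ≢0)) ⟩
      0ℚ                                          ∎
      where open ≡-Reasoning
  kernel-nontrivial {suc e} {suc u} (s≤s e<u) M | yes (p , pivot≢0)
    with kernel-nontrivial e<u (BackSubstitution.reduce (M p) pivot≢0 ∘ M ∘ punchIn p)
  ... | y , (i , yᵢ≢0) , reduced-rows = extend y , (suc i , yᵢ≢0) , rows
    where
    open BackSubstitution (M p) pivot≢0
    rows : ∀ r → M r · extend y ≡ 0ℚ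
    rows r with r Fin.≟ p
    ... | yes refl = pivot-row y
    ... | no r≢p   = begin
      M r · extend y                ≡⟨ reduced-row (M r) y ⟩
      reduce (M r) · y              ≡⟨ cong (λ r′ → reduce (M r′) · y) (Fin.punchIn-punchOut p≢r) ⟨
      reduce (M (punchIn p r₀)) · y ≡⟨ reduced-rows r₀ ⟩
      0ℚ                            ∎
      where
      open ≡-Reasoning
      p≢r = r≢p ∘ sym
      r₀ = punchOut p≢r

  LineSumsVanish : (n : ℕ) → Tensor n → Set
  LineSumsVanish n D =
      (∀ j k → ∑ n (λ i → D i j k) ≡ 0ℚ)
    × (∀ i k → ∑ n (λ j → D i j k) ≡ 0ℚ)
    × (∀ i j → ∑ n (λ k → D i j k) ≡ 0ℚ)

  reduced⇒lineSumsVanish : ∀ m (D : Tensor (suc m)) →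
    (∀ i j → ∑ (suc m) (λ k → D i j k) ≡ 0ℚ) →
    (∀ i k → ∑ (suc m) (λ j → D i j (suc k)) ≡ 0ℚ) →
    (∀ j k → ∑ (suc m) (λ i → D i (suc j) (suc k)) ≡ 0ℚ) →
    LineSumsVanish (suc m) D
  reduced⇒lineSumsVanish m D ∑ₖ≡0 ∑ⱼ≡0ₛ ∑ᵢ≡0ₛₛ = ∑ᵢ≡0 , ∑ⱼ≡0 , ∑ₖ≡0
    where
    n = suc m
    I J : Fin n → Fin n → ℚ
    I j k = ∑ n (λ i → D i j k)
    J i k = ∑ n (λ j → D i j k)

    ∑ⱼ≡0 : ∀ i k → J i k ≡ 0ℚ
    ∑ⱼ≡0 i zero    = ∑-head m (J i) (trans (∑-comm n n (λ k j → D i j k)) (∑-0 n (∑ₖ≡0 i))) (∑ⱼ≡0ₛ i)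
    ∑ⱼ≡0 i (suc k) = ∑ⱼ≡0ₛ i k

    ∑ⱼI≡0 : ∀ k → ∑ n (λ j → I j k) ≡ 0ℚ
    ∑ⱼI≡0 k = trans (∑-comm n n (λ j i → D i j k)) (∑-0 n (λ i → ∑ⱼ≡0 i k))

    ∑ₖI≡0 : ∀ j → ∑ n (I j) ≡ 0ℚ
    ∑ₖI≡0 j = trans (∑-comm n n (λ k i → D i j k)) (∑-0 n (λ i → ∑ₖ≡0 i j))

    ∑ᵢ≡0ₛ₀ : ∀ j → I (suc j) zero ≡ 0ℚ
    ∑ᵢ≡0ₛ₀ j = ∑-head m (I (suc j)) (∑ₖI≡0 (suc j)) (∑ᵢ≡0ₛₛ j)

    ∑ᵢ≡0 : ∀ j k → I j k ≡ 0ℚ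
    ∑ᵢ≡0 zero    zero    = ∑-head m (λ j → I j zero) (∑ⱼI≡0 zero) ∑ᵢ≡0ₛ₀
    ∑ᵢ≡0 zero    (suc k) = ∑-head m (λ j → I j (suc k)) (∑ⱼI≡0 (suc k)) (λ j → ∑ᵢ≡0ₛₛ j k)
    ∑ᵢ≡0 (suc j) zero    = ∑ᵢ≡0ₛ₀ j
    ∑ᵢ≡0 (suc j) (suc k) = ∑ᵢ≡0ₛₛ j k

  infix 4 _⊆ₛ_
  _⊆ₛ_ : ∀ {n} → Tensor n → Tensor n → Set
  D ⊆ₛ A = ∀ i j k → A i j k ≡ 0ℚ → D i j k ≡ 0ℚ

  private
    1+∣∣-positive : ∀ d → ℚ.Positive (1ℚ + ∣ d ∣)
    1+∣∣-positive d = ℚ.pos+nonNeg⇒pos 1ℚ ∣ d ∣ {{ℚ.∣-∣-nonNeg d}}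

    1/[1+∣_∣] : ℚ → ℚ
    1/[1+∣ d ∣] = ℚ.1/ (1ℚ + ∣ d ∣) where instance _ = ℚ.pos⇒nonZero (1ℚ + ∣ d ∣) {{1+∣∣-positive d}}

    1/[1+∣∣]-positive : ∀ d → ℚ.Positive 1/[1+∣ d ∣]
    1/[1+∣∣]-positive d = ℚ.1/pos⇒pos (1ℚ + ∣ d ∣) {{1+∣∣-positive d}}

    1/[1+∣∣]-inverse : ∀ d → 1/[1+∣ d ∣] * (1ℚ + ∣ d ∣) ≡ 1ℚ
    1/[1+∣∣]-inverse d = ℚ.*-inverseˡ (1ℚ + ∣ d ∣) {{ℚ.pos⇒nonZero (1ℚ + ∣ d ∣) {{1+∣∣-positive d}}}}

  -- The value 1 at a = 0 is arbitrary: there the perturbation d will vanish.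
  safeStep : ℚ → ℚ → ℚ
  safeStep a d with a ℚ.≟ 0ℚ
  ... | yes _ = 1ℚ
  ... | no _  = a * 1/[1+∣ d ∣]

  safeStep-positive : ∀ {a} d → 0ℚ ≤ a → 0ℚ < safeStep a d
  safeStep-positive {a} d 0≤a with a ℚ.≟ 0ℚ
  ... | yes _  = ℚ.positive⁻¹ 1ℚ
  ... | no a≢0 = ℚ.positive⁻¹ (a * 1/[1+∣ d ∣]) {{ℚ.pos*pos⇒pos a {{a>0}} 1/[1+∣ d ∣] {{1/[1+∣∣]-positive d}}}}
    where a>0 = ℚ.nonNeg∧nonZero⇒pos a {{ℚ.nonNegative 0≤a}} {{ℚ.≢-nonZero a≢0}}

  safeStep-sound : ∀ {a d e} → 0ℚ ≤ a → (a ≡ 0ℚ → d ≡ 0ℚ) → 0ℚ ≤ e → e ≤ safeStep a d → e * ∣ d ∣ ≤ a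
  safeStep-sound {a} {d} {e} 0≤a d≡0 0≤e e≤step with a ℚ.≟ 0ℚ
  ... | yes a≡0 = begin
    e * ∣ d ∣  ≡⟨ cong (λ x → e * ∣ x ∣) (d≡0 a≡0) ⟩
    e * 0ℚ    ≡⟨ ℚ.*-zeroʳ e ⟩
    0ℚ        ≤⟨ 0≤a ⟩
    a         ∎
    where open ℚ.≤-Reasoning
  ... | no _ = begin
    e * ∣ d ∣              ≤⟨ ℚ.*-monoˡ-≤-nonNeg e {{ℚ.nonNegative 0≤e}} ∣d∣≤q ⟩
    e * q                  ≤⟨ ℚ.*-monoʳ-≤-nonNeg q {{ℚ.pos⇒nonNeg q {{1+∣∣-positive d}}}} e≤step ⟩
    a * 1/[1+∣ d ∣] * q    ≡⟨ ℚ.*-assoc a 1/[1+∣ d ∣] q ⟩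
    a * (1/[1+∣ d ∣] * q)  ≡⟨ cong (a *_) (1/[1+∣∣]-inverse d) ⟩
    a * 1ℚ                 ≡⟨ ℚ.*-identityʳ a ⟩
    a                      ∎
    where
    open ℚ.≤-Reasoning
    q = 1ℚ + ∣ d ∣
    ∣d∣≤q : ∣ d ∣ ≤ q
    ∣d∣≤q = subst (_≤ q) (ℚ.+-identityˡ ∣ d ∣) (ℚ.+-monoˡ-≤ ∣ d ∣ (ℚ.nonNegative⁻¹ 1ℚ))

  safeStep-keeps-nonneg : ∀ {a d e} → 0ℚ ≤ a → (a ≡ 0ℚ → d ≡ 0ℚ) → 0ℚ ≤ e → e ≤ safeStep a d →
                          0ℚ ≤ a + e * d × 0ℚ ≤ a + - e * d
  safeStep-keeps-nonneg {a} {d} {e} 0≤a d≡0 0≤e e≤step = ∣x∣≤a⇒0≤a+x ∣ed∣≤a , ∣x∣≤a⇒0≤a+x ∣-ed∣≤a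
    where
    ∣ed∣≡e∣d∣ : ∣ e * d ∣ ≡ e * ∣ d ∣
    ∣ed∣≡e∣d∣ = trans (ℚ.∣p*q∣≡∣p∣*∣q∣ e d) (cong (_* ∣ d ∣) (ℚ.0≤p⇒∣p∣≡p 0≤e))
    ∣ed∣≤a : ∣ e * d ∣ ≤ a
    ∣ed∣≤a = subst (_≤ a) (sym ∣ed∣≡e∣d∣) (safeStep-sound 0≤a d≡0 0≤e e≤step)
    ∣-ed∣≡∣ed∣ : ∣ - e * d ∣ ≡ ∣ e * d ∣
    ∣-ed∣≡∣ed∣ = trans (cong ∣_∣ (sym (ℚ.neg-distribˡ-* e d))) (ℚ.∣-p∣≡∣p∣ (e * d))
    ∣-ed∣≤a : ∣ - e * d ∣ ≤ a
    ∣-ed∣≤a = subst (_≤ a) (sym ∣-ed∣≡∣ed∣) ∣ed∣≤a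

  minimum : ∀ n → Vector ℚ n → ℚ
  minimum zero    f = 1ℚ
  minimum (suc n) f = f zero ⊓ minimum n (tail f)

  minimum-≤ : ∀ n (f : Vector ℚ n) i → minimum n f ≤ f i
  minimum-≤ (suc n) f zero    = ℚ.p⊓q≤p (f zero) (minimum n (tail f))
  minimum-≤ (suc n) f (suc i) = ℚ.≤-trans (ℚ.p⊓q≤q (f zero) (minimum n (tail f))) (minimum-≤ n (tail f) i)

  minimum-positive : ∀ n (f : Vector ℚ n) → (∀ i → 0ℚ < f i) → 0ℚ < minimum n f
  minimum-positive zero    f f>0 = ℚ.positive⁻¹ 1ℚ
  minimum-positive (suc n) f f>0 with ℚ.⊓-sel (f zero) (minimum n (tail f))
  ... | inj₁ min≡head = subst (0ℚ <_) (sym min≡head) (f>0 zero)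
  ... | inj₂ min≡rest = subst (0ℚ <_) (sym min≡rest) (minimum-positive n (tail f) (f>0 ∘ suc))

  _+[_]_ : ∀ {n} → Tensor n → ℚ → Tensor n → Tensor n
  (A +[ c ] D) i j k = A i j k + c * D i j k

  ∑-+[] : ∀ n c (a d : Vector ℚ n) → ∑ n (λ i → a i + c * d i) ≡ ∑ n a + c * ∑ n d
  ∑-+[] n c a d = trans (∑-distrib-+ n a _) (cong (∑ n a +_) (∑-*ˡ n c d))

  lineStochastic-+[] : ∀ {n A D} c → LineStochastic n A → LineSumsVanish n D →
                       (∀ i j k → 0ℚ ≤ (A +[ c ] D) i j k) → LineStochastic n (A +[ c ] D)
  lineStochastic-+[] {n} c (_ , ∑ᵢA , ∑ⱼA , ∑ₖA) (∑ᵢD , ∑ⱼD , ∑ₖD) nonneg =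
    nonneg ,
    (λ j k → line (∑ᵢA j k) (∑ᵢD j k)) ,
    (λ i k → line (∑ⱼA i k) (∑ⱼD i k)) ,
    (λ i j → line (∑ₖA i j) (∑ₖD i j))
    where
    line : ∀ {a d : Vector ℚ n} → ∑ n a ≡ 1ℚ → ∑ n d ≡ 0ℚ → ∑ n (λ i → a i + c * d i) ≡ 1ℚ
    line {a} {d} ∑a≡1 ∑d≡0 = begin
      ∑ n (λ i → a i + c * d i) ≡⟨ ∑-+[] n c a d ⟩
      ∑ n a + c * ∑ n d         ≡⟨ cong₂ (λ x y → x + c * y) ∑a≡1 ∑d≡0 ⟩
      1ℚ + c * 0ℚ               ≡⟨ cong (1ℚ +_) (ℚ.*-zeroʳ c) ⟩
      1ℚ                        ∎
      where open ≡-Reasoning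

  lineSumsVanish-difference : ∀ {n A B} → LineStochastic n A → LineStochastic n B →
                              LineSumsVanish n (B +[ - 1ℚ ] A)
  lineSumsVanish-difference {n} (_ , ∑ᵢA , ∑ⱼA , ∑ₖA) (_ , ∑ᵢB , ∑ⱼB , ∑ₖB) =
    (λ j k → line (∑ᵢB j k) (∑ᵢA j k)) ,
    (λ i k → line (∑ⱼB i k) (∑ⱼA i k)) ,
    (λ i j → line (∑ₖB i j) (∑ₖA i j))
    where
    line : ∀ {b a : Vector ℚ n} → ∑ n b ≡ 1ℚ → ∑ n a ≡ 1ℚ → ∑ n (λ i → b i + - 1ℚ * a i) ≡ 0ℚ
    line {b} {a} ∑b≡1 ∑a≡1 = trans (∑-+[] n (- 1ℚ) b a) (cong₂ (λ x y → x + - 1ℚ * y) ∑b≡1 ∑a≡1)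

  vertex-rigid : ∀ {n A D} → IsVertex n A → LineSumsVanish n D → D ⊆ₛ A → ∀ i j k → D i j k ≡ 0ℚ
  vertex-rigid {n} {A} {D} (A∈𝓛 , extreme) ∑D≡0 D⊆ₛA i j k =
    positive*x≡0⇒x≡0 0<ε (+-identityʳ-unique (A i j k) (ε * D i j k) (A₊≐A i j k))
    where
    steps : Tensor n
    steps i j k = safeStep (A i j k) (D i j k)
    ε = minimum n λ i → minimum n λ j → minimum n λ k → steps i j k
    0<ε : 0ℚ < ε
    0<ε = minimum-positive n _ λ i → minimum-positive n _ λ j → minimum-positive n _ λ k →
          safeStep-positive (D i j k) (proj₁ A∈𝓛 i j k)
    ε≤steps : ∀ i j k → ε ≤ steps i j k
    ε≤steps i j k = ℚ.≤-trans (minimum-≤ n _ i) (ℚ.≤-trans (minimum-≤ n _ j) (minimum-≤ n _ k))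
    ±ε-nonneg : ∀ i j k → 0ℚ ≤ A i j k + ε * D i j k × 0ℚ ≤ A i j k + - ε * D i j k
    ±ε-nonneg i j k = safeStep-keeps-nonneg (proj₁ A∈𝓛 i j k) (D⊆ₛA i j k) (ℚ.<⇒≤ 0<ε) (ε≤steps i j k)
    A₊ A₋ : Tensor n
    A₊ = A +[ ε ] D
    A₋ = A +[ - ε ] D
    A≡½A₊+½A₋ : ∀ i j k → A i j k ≡ ½ * A₊ i j k + (1ℚ - ½) * A₋ i j k
    A≡½A₊+½A₋ i j k = midpoint (A i j k) ε (D i j k)
      where
      midpoint : ∀ a e d → a ≡ ½ * (a + e * d) + (1ℚ - ½) * (a + - e * d)
      midpoint = solve-∀ ℚ-ring
    A₊≐A : A₊ ≐ A
    A₊≐A = proj₁ (extreme A₊ A₋ ½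
      (lineStochastic-+[] ε A∈𝓛 ∑D≡0 (λ i j k → proj₁ (±ε-nonneg i j k)))
      (lineStochastic-+[] (- ε) A∈𝓛 ∑D≡0 (λ i j k → proj₂ (±ε-nonneg i j k)))
      (ℚ.positive⁻¹ ½) (from-yes (½ ℚ.<? 1ℚ)) A≡½A₊+½A₋)

  vertex-determined-by-support : ∀ {n A B} → IsVertex n A → LineStochastic n B → B ⊆ₛ A → B ≐ A
  vertex-determined-by-support {n} {A} {B} A-vertex@(A∈𝓛 , _) B∈𝓛 B⊆ₛA i j k =
    difference≡0 (vertex-rigid A-vertex (lineSumsVanish-difference A∈𝓛 B∈𝓛) B-A⊆ₛA i j k)
    where
    B-A⊆ₛA : B +[ - 1ℚ ] A ⊆ₛ A
    B-A⊆ₛA i j k Aᵢⱼₖ≡0 = cong₂ (λ b a → b + - 1ℚ * a) (B⊆ₛA i j k Aᵢⱼₖ≡0) Aᵢⱼₖ≡0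
    difference≡0 : ∀ {b a} → b + - 1ℚ * a ≡ 0ℚ → b ≡ a
    difference≡0 {b} {a} b-a≡0 = trans (regroup b a) (trans (cong (_+ a) b-a≡0) (ℚ.+-identityˡ a))
      where
      regroup : ∀ b a → b ≡ (b + - 1ℚ * a) + a
      regroup = solve-∀ ℚ-ring

  Unique-lookup-injective : ∀ {A : Set} {xs : List A} → Unique xs → ∀ s t → lookup xs s ≡ lookup xs t → s ≡ t
  Unique-lookup-injective (_ ∷ _)  zero    zero    _  = refl
  Unique-lookup-injective (x∉ ∷ _) zero    (suc t) eq = ⊥-elim (All.lookup x∉ (∈-lookup t) eq)
  Unique-lookup-injective (x∉ ∷ _) (suc s) zero    eq = ⊥-elim (All.lookup x∉ (∈-lookup s) (sym eq))
  Unique-lookup-injective (_ ∷ u)  (suc s) (suc t) eq = cong suc (Unique-lookup-injective u s t eq)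

  Cell : ℕ → Set
  Cell n = Fin n × Fin n × Fin n

  cells : ∀ n → List (Cell n)
  cells n = cartesianProduct (allFin n) (cartesianProduct (allFin n) (allFin n))

  cells-unique : ∀ n → Unique (cells n)
  cells-unique n =
    Unique.cartesianProduct⁺ (Unique.allFin⁺ n) (Unique.cartesianProduct⁺ (Unique.allFin⁺ n) (Unique.allFin⁺ n))

  entry : ∀ {n} → Tensor n → Cell n → ℚ
  entry A (i , j , k) = A i j k

  nonzero? : ∀ {n} (A : Tensor n) → Decidable (λ c → entry A c ≢ 0ℚ)
  nonzero? A c = ¬? (entry A c ℚ.≟ 0ℚ)

  support : ∀ {n} → Tensor n → List (Cell n)
  support {n} A = filter (nonzero? A) (cells n)

  unit : ∀ {n} → Cell n → Tensor n
  unit (a , b , c) i j k = δ a i * (δ b j * δ c k)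

  unit-diag : ∀ {n} (c : Cell n) → entry (unit c) c ≡ 1ℚ
  unit-diag (a , b , c) rewrite δ-refl a | δ-refl b | δ-refl c = refl

  unit-off-diag : ∀ {n} {c d : Cell n} → c ≢ d → entry (unit c) d ≡ 0ℚ
  unit-off-diag {c = a , b , c} {i , j , k} c≢d with a Fin.≟ i
  ... | no _ = ℚ.*-zeroˡ (δ b j * δ c k)
  ... | yes refl with b Fin.≟ j
  ...   | no _ = cong (1ℚ *_) (ℚ.*-zeroˡ (δ c k))
  ...   | yes refl with c Fin.≟ k
  ...     | no _     = refl
  ...     | yes refl = ⊥-elim (c≢d refl)

  lineI lineJ lineK : ∀ {n} → Cell n → Fin n → Fin n → ℚ
  lineI (a , b , c) j k = δ b j * δ c k
  lineJ (a , b , c) i k = δ a i * δ c k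
  lineK (a , b , c) i j = δ a i * δ b j

  combination : ∀ {n s} → (Fin s → Cell n) → Vector ℚ s → Tensor n
  combination {s = s} cell x i j k = ∑ s (λ t → unit (cell t) i j k * x t)

  module _ {n s} (cell : Fin s → Cell n) (x : Vector ℚ s) where

    private
      a b c : Fin s → Fin n
      a = proj₁ ∘ cell
      b = proj₁ ∘ proj₂ ∘ cell
      c = proj₂ ∘ proj₂ ∘ cell

      ∑-combination : (d : Fin s → Fin n) (line : Vector ℚ s) (term : Fin n → Fin s → ℚ) →
                      (∀ i t → term i t ≡ δ (d t) i * (line t * x t)) →
                      ∑ n (λ i → ∑ s (term i)) ≡ line · x
      ∑-combination d line term term≡ =
        trans (∑-cong n (λ i → ∑-cong s (term≡ i))) (∑-∑-δ n s d (λ t → line t * x t))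

    ∑ᵢ-combination : ∀ j k → ∑ n (λ i → combination cell x i j k) ≡ (λ t → lineI (cell t) j k) · x
    ∑ᵢ-combination j k = ∑-combination a (λ t → lineI (cell t) j k) _ λ i t →
      reorder (δ (a t) i) (δ (b t) j) (δ (c t) k) (x t)
      where
      reorder : ∀ p q r y → p * (q * r) * y ≡ p * (q * r * y)
      reorder = solve-∀ ℚ-ring

    ∑ⱼ-combination : ∀ i k → ∑ n (λ j → combination cell x i j k) ≡ (λ t → lineJ (cell t) i k) · x
    ∑ⱼ-combination i k = ∑-combination b (λ t → lineJ (cell t) i k) _ λ j t →
      reorder (δ (a t) i) (δ (b t) j) (δ (c t) k) (x t)
      where
      reorder : ∀ p q r y → p * (q * r) * y ≡ q * (p * r * y)
      reorder = solve-∀ ℚ-ring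

    ∑ₖ-combination : ∀ i j → ∑ n (λ k → combination cell x i j k) ≡ (λ t → lineK (cell t) i j) · x
    ∑ₖ-combination i j = ∑-combination c (λ t → lineK (cell t) i j) _ λ k t →
      reorder (δ (a t) i) (δ (b t) j) (δ (c t) k) (x t)
      where
      reorder : ∀ p q r y → p * (q * r) * y ≡ r * (p * q * y)
      reorder = solve-∀ ℚ-ring

  module Support {n} (A : Tensor n) where

    s : ℕ
    s = length (support A)

    cell : Fin s → Cell n
    cell = lookup (support A)

    cell-nonzero : ∀ t → entry A (cell t) ≢ 0ℚ
    cell-nonzero t = All.lookup (All.all-filter (nonzero? A) (cells n)) (∈-lookup t)

    cell-injective : ∀ t t′ → cell t ≡ cell t′ → t ≡ t′
    cell-injective = Unique-lookup-injective (Unique.filter⁺ (nonzero? A) (cells-unique n))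

    combination⊆ₛA : ∀ x → combination cell x ⊆ₛ A
    combination⊆ₛA x i j k Aᵢⱼₖ≡0 = ∑-0 s λ t →
      trans (cong (_* x t) (unit-off-diag λ cellₜ≡ijk → cell-nonzero t (trans (cong (entry A) cellₜ≡ijk) Aᵢⱼₖ≡0)))
            (ℚ.*-zeroˡ (x t))

    combination-at-cell : ∀ x t → entry (combination cell x) (cell t) ≡ x t
    combination-at-cell x t = begin
      ∑ s (λ t′ → entry (unit (cell t′)) (cell t) * x t′) ≡⟨ ∑-single s t _ off-diagonal ⟩
      entry (unit (cell t)) (cell t) * x t               ≡⟨ cong (_* x t) (unit-diag (cell t)) ⟩
      1ℚ * x t                                           ≡⟨ ℚ.*-identityˡ (x t) ⟩
      x t                                                ∎
      where
      open ≡-Reasoning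
      off-diagonal : ∀ t′ → t′ ≢ t → entry (unit (cell t′)) (cell t) * x t′ ≡ 0ℚ
      off-diagonal t′ t′≢t =
        trans (cong (_* x t′) (unit-off-diag (t′≢t ∘ cell-injective t′ t))) (ℚ.*-zeroˡ (x t′))

  support-size-bound : ∀ m {A : Tensor (suc m)} → IsVertex (suc m) A →
                       length (support A) ≤ℕ suc m *ℕ suc m +ℕ (suc m *ℕ m +ℕ m *ℕ m)
  support-size-bound m {A} A-vertex = ℕ.≮⇒≥ no-kernel
    where
    open Support A
    n = suc m

    rowK : Fin n × Fin n → Vector ℚ s
    rowK (i , j) t = lineK (cell t) i j
    rowJ : Fin n × Fin m → Vector ℚ s
    rowJ (i , k) t = lineJ (cell t) i (suc k)
    rowI : Fin m × Fin m → Vector ℚ s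
    rowI (j , k) t = lineI (cell t) (suc j) (suc k)

    rowsK : Fin (n *ℕ n) → Vector ℚ s
    rowsK = rowK ∘ remQuot n
    rowsJ : Fin (n *ℕ m) → Vector ℚ s
    rowsJ = rowJ ∘ remQuot m
    rowsI : Fin (m *ℕ m) → Vector ℚ s
    rowsI = rowI ∘ remQuot m
    rows : Fin (n *ℕ n +ℕ (n *ℕ m +ℕ m *ℕ m)) → Vector ℚ s
    rows = rowsK ++ (rowsJ ++ rowsI)

    kIndex : Fin n → Fin n → Fin (n *ℕ n +ℕ (n *ℕ m +ℕ m *ℕ m))
    kIndex i j = combine i j ↑ˡ (n *ℕ m +ℕ m *ℕ m)
    jIndex : Fin n → Fin m → Fin (n *ℕ n +ℕ (n *ℕ m +ℕ m *ℕ m))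
    jIndex i k = n *ℕ n ↑ʳ (combine i k ↑ˡ m *ℕ m)
    iIndex : Fin m → Fin m → Fin (n *ℕ n +ℕ (n *ℕ m +ℕ m *ℕ m))
    iIndex j k = n *ℕ n ↑ʳ (n *ℕ m ↑ʳ combine j k)

    rows-K : ∀ i j → rows (kIndex i j) ≡ rowK (i , j)
    rows-K i j = trans (lookup-++ˡ rowsK (rowsJ ++ rowsI) (combine i j)) (cong rowK (Fin.remQuot-combine i j))

    rows-J : ∀ i k → rows (jIndex i k) ≡ rowJ (i , k)
    rows-J i k = trans (lookup-++ʳ rowsK (rowsJ ++ rowsI) (combine i k ↑ˡ m *ℕ m))
                       (trans (lookup-++ˡ rowsJ rowsI (combine i k)) (cong rowJ (Fin.remQuot-combine i k)))

    rows-I : ∀ j k → rows (iIndex j k) ≡ rowI (j , k)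
    rows-I j k = trans (lookup-++ʳ rowsK (rowsJ ++ rowsI) (n *ℕ m ↑ʳ combine j k))
                       (trans (lookup-++ʳ rowsJ rowsI (combine j k)) (cong rowI (Fin.remQuot-combine j k)))

    no-kernel : ¬ (n *ℕ n +ℕ (n *ℕ m +ℕ m *ℕ m) <ℕ s)
    no-kernel rows<s with kernel-nontrivial rows<s rows
    ... | x , (t , xₜ≢0) , rows·x≡0 = xₜ≢0 (begin
      x t                                  ≡⟨ combination-at-cell x t ⟨
      entry (combination cell x) (cell t)  ≡⟨ vertex-rigid A-vertex line-sums (combination⊆ₛA x) _ _ _ ⟩
      0ℚ                                   ∎)
      where
      open ≡-Reasoning
      row·x≡0 : ∀ r {row} → rows r ≡ row → row · x ≡ 0ℚ
      row·x≡0 r rowsᵣ≡row = subst (λ row → row · x ≡ 0ℚ) rowsᵣ≡row (rows·x≡0 r)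
      line-sums : LineSumsVanish n (combination cell x)
      line-sums = reduced⇒lineSumsVanish m (combination cell x)
        (λ i j → trans (∑ₖ-combination cell x i j) (row·x≡0 (kIndex i j) (rows-K i j)))
        (λ i k → trans (∑ⱼ-combination cell x i (suc k)) (row·x≡0 (jIndex i k) (rows-J i k)))
        (λ j k → trans (∑ᵢ-combination cell x (suc j) (suc k)) (row·x≡0 (iIndex j k) (rows-I j k)))

open Vertices
open import Data.Nat using (_+_; _*_; _∸_; _^_; _≤_)
open import Data.Nat.Combinatorics using (_C_; nCn≡1; nCk+nC[k+1]≡[n+1]C[k+1])

weight : List Bool → ℕ
weight []           = 0
weight (true  ∷ bs) = suc (weight bs)
weight (false ∷ bs) = weight bs

weight-map-does : ∀ {A : Set} {P : A → Set} (P? : Decidable P) xs →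
                  weight (map (does ∘ P?) xs) ≡ length (filter P? xs)
weight-map-does P? []       = refl
weight-map-does P? (x ∷ xs) with does (P? x)
... | true  = cong suc (weight-map-does P? xs)
... | false = weight-map-does P? xs

bitStrings : (N r : ℕ) → List (List Bool)
bitStrings zero    r       = [] ∷ []
bitStrings (suc N) zero    = map (false ∷_) (bitStrings N zero)
bitStrings (suc N) (suc r) = map (false ∷_) (bitStrings N (suc r)) List.++ map (true ∷_) (bitStrings N r)

∈-bitStrings : ∀ N r bs → length bs ≡ N → weight bs ≤ r → bs ∈ bitStrings N r
∈-bitStrings zero    r       []           refl _         = here refl
∈-bitStrings (suc N) zero    (false ∷ bs) refl w≤r       = ∈-map⁺ (false ∷_) (∈-bitStrings N zero bs refl w≤r)
∈-bitStrings (suc N) (suc r) (false ∷ bs) refl w≤r       =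
  ∈-++⁺ˡ (∈-map⁺ (false ∷_) (∈-bitStrings N (suc r) bs refl w≤r))
∈-bitStrings (suc N) (suc r) (true  ∷ bs) refl (s≤s w≤r) =
  ∈-++⁺ʳ _ (∈-map⁺ (true ∷_) (∈-bitStrings N r bs refl w≤r))

length-bitStrings : ∀ N r → length (bitStrings N r) ≤ (N + r) C N
length-bitStrings zero    r       = ℕ.≤-refl
length-bitStrings (suc N) zero    = begin
  length (map (false ∷_) (bitStrings N zero)) ≡⟨ List.length-map (false ∷_) (bitStrings N zero) ⟩
  length (bitStrings N zero)                  ≤⟨ length-bitStrings N zero ⟩
  (N + 0) C N                                 ≡⟨ cong (_C N) (ℕ.+-identityʳ N) ⟩
  N C N                                       ≡⟨ trans (nCn≡1 N) (sym (nCn≡1 (suc N))) ⟩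
  suc N C suc N                               ≡⟨ cong (_C suc N) (ℕ.+-identityʳ (suc N)) ⟨
  (suc N + 0) C suc N                         ∎
  where open ℕ.≤-Reasoning
length-bitStrings (suc N) (suc r) = begin
  length (map (false ∷_) (bitStrings N (suc r)) List.++ map (true ∷_) (bitStrings N r))
    ≡⟨ List.length-++ (map (false ∷_) (bitStrings N (suc r))) ⟩
  length (map (false ∷_) (bitStrings N (suc r))) + length (map (true ∷_) (bitStrings N r))
    ≡⟨ cong₂ _+_ (List.length-map (false ∷_) (bitStrings N (suc r))) (List.length-map (true ∷_) (bitStrings N r)) ⟩
  length (bitStrings N (suc r)) + length (bitStrings N r)
    ≤⟨ ℕ.+-mono-≤ (length-bitStrings N (suc r)) (length-bitStrings N r) ⟩
  (N + suc r) C N + (N + r) C N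
    ≤⟨ ℕ.+-monoʳ-≤ ((N + suc r) C N) (ℕ.m≤m+n ((N + r) C N) ((N + r) C suc N)) ⟩
  (N + suc r) C N + ((N + r) C N + (N + r) C suc N)
    ≡⟨ cong ((N + suc r) C N +_) (nCk+nC[k+1]≡[n+1]C[k+1] (N + r) N) ⟩
  (N + suc r) C N + (suc N + r) C suc N
    ≡⟨ cong (λ M → (N + suc r) C N + M C suc N) (ℕ.+-suc N r) ⟨
  (N + suc r) C N + (N + suc r) C suc N
    ≡⟨ nCk+nC[k+1]≡[n+1]C[k+1] (N + suc r) N ⟩
  (suc N + suc r) C suc N
    ∎
  where open ℕ.≤-Reasoning

∈-─ : ∀ {A : Set} {x y : A} {ys} (y∈ys : y ∈ ys) → x ∈ ys → x ≢ y → x ∈ (ys ─ y∈ys)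
∈-─ (here refl)  (here refl)  x≢y = ⊥-elim (x≢y refl)
∈-─ (here refl)  (there x∈ys) _   = x∈ys
∈-─ (there _)    (here refl)  _   = here refl
∈-─ (there y∈ys) (there x∈ys) x≢y = there (∈-─ y∈ys x∈ys x≢y)

Unique∧⊆⇒length≤ : ∀ {A : Set} {xs ys : List A} → Unique xs → xs ⊆ ys → length xs ≤ length ys
Unique∧⊆⇒length≤ {xs = []}          _          _     = z≤n
Unique∧⊆⇒length≤ {xs = x ∷ xs} {ys} (x∉xs ∷ u) xs⊆ys = begin
  suc (length xs)          ≤⟨ s≤s (Unique∧⊆⇒length≤ u xs⊆ys─x) ⟩
  suc (length (ys ─ x∈ys)) ≡⟨ List.length-removeAt′ ys _ ⟨
  length ys                ∎
  where
  open ℕ.≤-Reasoning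
  x∈ys = xs⊆ys (here refl)
  xs⊆ys─x : xs ⊆ (ys ─ x∈ys)
  xs⊆ys─x z∈xs = ∈-─ x∈ys (xs⊆ys (there z∈xs)) λ { refl → All.lookup x∉xs z∈xs refl }

map-≡⇒≡ : ∀ {A B : Set} {f g : A → B} {x} xs → map f xs ≡ map g xs → x ∈ xs → f x ≡ g x
map-≡⇒≡ (_ ∷ _)  fxs≡gxs (here refl)  = proj₁ (List.∷-injective fxs≡gxs)
map-≡⇒≡ (_ ∷ xs) fxs≡gxs (there x∈xs) = map-≡⇒≡ xs (proj₂ (List.∷-injective fxs≡gxs)) x∈xs

length-cartesianProduct : ∀ {A B : Set} (xs : List A) (ys : List B) →
                          length (cartesianProduct xs ys) ≡ length xs * length ys
length-cartesianProduct []       ys = refl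
length-cartesianProduct (x ∷ xs) ys = begin
  length (map (x ,_) ys List.++ cartesianProduct xs ys)
    ≡⟨ List.length-++ (map (x ,_) ys) ⟩
  length (map (x ,_) ys) + length (cartesianProduct xs ys)
    ≡⟨ cong₂ _+_ (List.length-map (x ,_) ys) (length-cartesianProduct xs ys) ⟩
  length ys + length xs * length ys
    ∎
  where open ≡-Reasoning

length-cells : ∀ n → length (cells n) ≡ n ^ 3
length-cells n = begin
  length (cells n)
    ≡⟨ length-cartesianProduct (allFin n) _ ⟩
  length (allFin n) * length (cartesianProduct (allFin n) (allFin n))
    ≡⟨ cong₂ _*_ ∣allFin∣ (length-cartesianProduct (allFin n) (allFin n)) ⟩
  n * (length (allFin n) * length (allFin n))
    ≡⟨ cong (n *_) (cong₂ _*_ ∣allFin∣ ∣allFin∣) ⟩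
  n * (n * n)
    ≡⟨ cong (λ k → n * (n * k)) (ℕ.*-identityʳ n) ⟨
  n ^ 3
    ∎
  where
  open ≡-Reasoning
  ∣allFin∣ = List.length-tabulate {n = n} (λ i → i)

∈-cells : ∀ {n} i j k → (i , j , k) ∈ cells n
∈-cells i j k = ∈-cartesianProduct⁺ (∈-allFin i) (∈-cartesianProduct⁺ (∈-allFin j) (∈-allFin k))

supportPattern : ∀ {n} → Tensor n → List Bool
supportPattern {n} A = map (does ∘ nonzero? A) (cells n)

supportPattern-injective : ∀ {n A B} → LineStochastic n A → IsVertex n B → supportPattern A ≡ supportPattern B → A ≐ B
supportPattern-injective {n} {A} {B} A∈𝓛 B-vertex same-pattern = vertex-determined-by-support B-vertex A∈𝓛 A⊆ₛB
  where
  A⊆ₛB : A ⊆ₛ B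
  A⊆ₛB i j k Bᵢⱼₖ≡0 with A i j k ℚ.≟ 0ℚ | map-≡⇒≡ (cells n) same-pattern (∈-cells i j k)
  ... | yes Aᵢⱼₖ≡0 | _        = Aᵢⱼₖ≡0
  ... | no _       | same-bit = contradiction (trans same-bit B-bit) λ ()
    where
    B-bit : does (nonzero? B (i , j , k)) ≡ false
    B-bit = dec-false (nonzero? B (i , j , k)) (λ Bᵢⱼₖ≢0 → Bᵢⱼₖ≢0 Bᵢⱼₖ≡0)

supportPatterns-unique : ∀ {n vs} → All (IsVertex n) vs → AllPairs (λ A B → ¬ (A ≐ B)) vs →
                         Unique (map supportPattern vs)
supportPatterns-unique []                    []                 = []
supportPatterns-unique (A-vertex ∷ vertices) (A≭vs ∷ distinct) =
  All.map⁺ (All.zipWith (λ (B-vertex , A≭B) → A≭B ∘ supportPattern-injective (proj₁ A-vertex) B-vertex)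
                        (vertices , A≭vs))
  ∷ supportPatterns-unique vertices distinct

-- The ring solver does not handle _^_, so the powers are spelled out.
vertex-bound-arithmetic : ∀ m → let n = suc m in
  n ^ 3 + (n * n + (n * m + m * m)) ≡ (n ^ 3 + 3 * n ^ 2 + 1) ∸ 3 * n
vertex-bound-arithmetic m = sym (trans (cong (_∸ 3 * suc m) (sym (expand m))) (ℕ.m+n∸n≡m _ (3 * suc m)))
  where
  expand : ∀ m → (1 + m) * ((1 + m) * ((1 + m) * 1)) + ((1 + m) * (1 + m) + ((1 + m) * m + m * m)) + 3 * (1 + m)
                 ≡ (1 + m) * ((1 + m) * ((1 + m) * 1)) + 3 * ((1 + m) * ((1 + m) * 1)) + 1
  expand = ℕ-solve-∀

mainTheorem4 : (n : ℕ) → 1 ≤ n →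
    VertexCountAtMost n (((n ^ 3 + 3 * n ^ 2 + 1) ∸ 3 * n) C (n ^ 3))
mainTheorem4 (suc m) _ vs vertices distinct = begin
  length vs                       ≡⟨ List.length-map supportPattern vs ⟨
  length (map supportPattern vs)  ≤⟨ Unique∧⊆⇒length≤ (supportPatterns-unique vertices distinct) patterns⊆ ⟩
  length (bitStrings N r)         ≤⟨ length-bitStrings N r ⟩
  (N + r) C N                     ≡⟨ cong₂ _C_ N+r≡ (length-cells n) ⟩
  ((n ^ 3 + 3 * n ^ 2 + 1) ∸ 3 * n) C (n ^ 3) ∎
  where
  open ℕ.≤-Reasoning
  n = suc m
  N = length (cells n)
  r = n * n + (n * m + m * m)
  N+r≡ : N + r ≡ (n ^ 3 + 3 * n ^ 2 + 1) ∸ 3 * n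
  N+r≡ = trans (cong (_+ r) (length-cells n)) (vertex-bound-arithmetic m)
  pattern∈bitStrings : ∀ {A} → IsVertex n A → supportPattern A ∈ bitStrings N r
  pattern∈bitStrings {A} A-vertex =
    ∈-bitStrings N r (supportPattern A) (List.length-map (does ∘ nonzero? A) (cells n))
      (subst (_≤ r) (sym (weight-map-does (nonzero? A) (cells n))) (support-size-bound m A-vertex))
  patterns∈ : All (_∈ bitStrings N r) (map supportPattern vs)
  patterns∈ = All.map⁺ (All.map pattern∈bitStrings vertices)
  patterns⊆ : map supportPattern vs ⊆ bitStrings N r
  patterns⊆ = All.lookup patterns∈
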